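{- Let $f\in\mathbb{Z}[x_1,\dots,x_d]$. The following are equivalent: (i) there exist $\mathbf{p}\in\operatorname{frame}^+(f)$ and $\mathbf{n}\in\mathbb{R}^d$ such that $\mathbf{p}$ is a vertex of $\operatorname{newton}(f)=\operatorname{conv}(\operatorname{frame}(f))$ with respect to $\mathbf{n}$; (ii) there exist $\mathbf{p}'\in\operatorname{frame}^+(f)$ and $\mathbf{n}'\in\mathbb{R}^d$ such that $\mathbf{p}'$ is a vertex of $\operatorname{conv}(\operatorname{frame}^-(f)\cup\{\mathbf{p}'\})$ with respect to $\mathbf{n}'$.
   Context: For $f=\sum_{\mathbf{p}\in F}f_\mathbf{p}\mathbf{x}^\mathbf{p}$ with $f_\mathbf{p}\neq0$ and $F\subset\mathbb{N}^d$ finite, $\operatorname{frame}(f)=F$, $\operatorname{frame}^+(f)=\{\mathbf{p}\in F\mid f_\mathbf{p}>0\}$, $\operatorname{frame}^-(f)=\{\mathbf{p}\in F\mid f_\mathbf{p}<0\}$. A point $\mathbf{p}$ is a vertex of a polytope $P$ with respect to $\mathbf{n}$ if $\mathbf{n}^T\mathbf{p}>\mathbf{n}^T\mathbf{q}$ for all $\mathbf{q}\in P\setminus\{\mathbf{p}\}$.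
   Formalization: The normals n and n′ are taken in ℚ^d rather than ℝ^d, and the convex hulls are formed in ℚ^d from rational weights. -}

module Defs where

open import Data.Nat using (ℕ)
open import Data.Integer as ℤ using (ℤ; +_)
open import Data.Rational as ℚ using (ℚ; 0ℚ; 1ℚ; _/_)
open import Data.Vec using (Vec; map; zipWith; foldr)
open import Data.List as List using (List)
open import Data.List.Membership.Propositional using (_∈_)
open import Data.List.Relation.Unary.All using (All)
open import Data.Product using (Σ; ∃; _×_; _,_)
open import Data.Sum using (_⊎_)
open import Relation.Binary.PropositionalEquality using (_≡_; _≢_)
open import Relation.Nullary using (¬_)

Exp : ℕ → Set
Exp d = Vec ℕ d

-- Points of ℚ^d (rational stand-in for ℝ^d).
Pt : ℕ → Set
Pt d = Vec ℚ d

record Poly (d : ℕ) : Set where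
  field
    coeff    : Exp d → ℤ
    support  : List (Exp d)
    complete : ∀ p → coeff p ≢ + 0 → p ∈ support
open Poly public

embed : ∀ {d} → Exp d → Pt d
embed = map (λ k → + k / 1)

PtSet : ℕ → Set₁
PtSet d = Pt d → Set

frame : ∀ {d} → Poly d → PtSet d
frame f x = Σ (Exp _) λ p → embed p ≡ x × coeff f p ≢ + 0

frame⁺ : ∀ {d} → Poly d → PtSet d
frame⁺ f x = Σ (Exp _) λ p → embed p ≡ x × + 0 ℤ.< coeff f p

frame⁻ : ∀ {d} → Poly d → PtSet d
frame⁻ f x = Σ (Exp _) λ p → embed p ≡ x × coeff f p ℤ.< + 0

_∪_ : ∀ {d} → PtSet d → PtSet d → PtSet d
(S ∪ T) x = S x ⊎ T x

｛_｝ : ∀ {d} → Pt d → PtSet d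
｛ p ｝ x = x ≡ p

_·_ : ∀ {d} → Pt d → Pt d → ℚ
u · v = foldr _ ℚ._+_ 0ℚ (zipWith ℚ._*_ u v)

_⊕_ : ∀ {d} → Pt d → Pt d → Pt d
_⊕_ = zipWith ℚ._+_

scale : ∀ {d} → ℚ → Pt d → Pt d
scale c = map (c ℚ.*_)

zeroPt : ∀ {d} → Pt d
zeroPt {d} = Data.Vec.replicate d 0ℚ

weightSum : ∀ {d} → List (Pt d × ℚ) → ℚ
weightSum = List.foldr (λ { (_ , w) acc → w ℚ.+ acc }) 0ℚ

combination : ∀ {d} → List (Pt d × ℚ) → Pt d
combination = List.foldr (λ { (x , w) acc → scale w x ⊕ acc }) zeroPt

conv : ∀ {d} → PtSet d → PtSet d
conv S q = ∃ λ ws →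
  All (λ { (x , w) → S x × 0ℚ ℚ.≤ w }) ws × weightSum ws ≡ 1ℚ × combination ws ≡ q

IsVertexWrt : ∀ {d} → PtSet d → Pt d → Pt d → Set
IsVertexWrt P n p = ∀ q → P q → q ≢ p → (n · q) ℚ.< (n · p)

{-# OPTIONS --safe #-}
-- (i) ⇒ (ii) because conv(frame⁻ f ∪ {p}) ⊆ newton(f) for every p ∈ frame⁺ f.
-- (ii) ⇒ (i): let p maximise ψ(x) = K n′·x + x·x over frame(f). Since 2 p·q < p·p + q·q
-- for q ≠ p, the maximiser p is a vertex of newton(f) w.r.t. K n′ + 2p. For K large, ψ ranks
-- points by n′·x first, and n′ puts every point of frame⁻ f strictly below p′ ∈ frame(f);
-- hence p ∉ frame⁻ f, so p ∈ frame⁺ f.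
module Submission where

open import Defs
open import Data.Nat using (ℕ)
open import Data.Rational using (ℚ; 0ℚ; 1ℚ; _+_; _*_; -_; _-_; _≤_; _<_; _⊔_; 1/_; Positive; NonNegative; NonZero; positive; negative)
open import Data.Rational.Properties
open import Data.Rational.Solver using (module +-*-Solver)
import Data.Integer as ℤ
import Data.Integer.Properties as ℤ
open import Algebra.Bundles using (CommutativeMonoid)
open import Algebra.Properties.Group +-0-group using (x∙y⁻¹≈ε⇒x≈y)
open import Algebra.Properties.CommutativeSemigroup (CommutativeMonoid.commutativeSemigroup +-0-commutativeMonoid)
  using () renaming (interchange to +-interchange)
open import Relation.Binary.Bundles using (DecTotalOrder)
open import Data.List using (List; []; _∷_; map; filter)
open import Data.List.Membership.Propositional using (_∈_)
open import Data.List.Membership.Propositional.Properties using (∈-map⁺; ∈-map⁻; ∈-filter⁺; ∈-filter⁻)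
open import Data.List.Relation.Unary.Any using (here; there)
open import Data.List.Relation.Unary.All as All using (All; []; _∷_)
open import Data.List.Extrema (DecTotalOrder.totalOrder ≤-decTotalOrder)
  using (argmax; argmax-all; f[⊥]≤f[argmax]; f[xs]≤f[argmax])
open import Data.Vec using ([]; _∷_)
open import Data.Vec.Properties using (≡-dec; map-cong; map-const; map-id; zipWith-identityˡ; zipWith-identityʳ)
open import Data.Product using (Σ; ∃; _×_; _,_; proj₁; proj₂)
open import Data.Sum using (_⊎_; inj₁; inj₂)
open import Function using (_∘_)
open import Function.Bundles using (_⇔_; mk⇔)
open import Relation.Binary.Definitions using (DecidableEquality; tri<; tri≈; tri>)
open import Relation.Binary.PropositionalEquality
open import Relation.Nullary using (Dec; yes; no; ¬?; contradiction)

open +-*-Solver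

module _ {d : ℕ} where

  _≟ₚ_ : DecidableEquality (Pt d)
  _≟ₚ_ = ≡-dec _≟_

  scale-zeroˡ : (x : Pt d) → scale 0ℚ x ≡ zeroPt
  scale-zeroˡ x = trans (map-cong *-zeroˡ x) (map-const x 0ℚ)

  scale-identityˡ : (x : Pt d) → scale 1ℚ x ≡ x
  scale-identityˡ x = trans (map-cong *-identityˡ x) (map-id x)

  ⊕-identityˡ : (x : Pt d) → zeroPt ⊕ x ≡ x
  ⊕-identityˡ = zipWith-identityˡ +-identityˡ

  ⊕-identityʳ : (x : Pt d) → x ⊕ zeroPt ≡ x
  ⊕-identityʳ = zipWith-identityʳ +-identityʳ

scale-distribʳ : ∀ {d} a b (x : Pt d) → scale a x ⊕ scale b x ≡ scale (a + b) x
scale-distribʳ a b []      = refl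
scale-distribʳ a b (c ∷ x) = cong₂ _∷_ (sym (*-distribʳ-+ c a b)) (scale-distribʳ a b x)

·-distribˡ-⊕ : ∀ {d} (m a b : Pt d) → m · (a ⊕ b) ≡ m · a + m · b
·-distribˡ-⊕ []      []      []      = sym (+-identityˡ 0ℚ)
·-distribˡ-⊕ (x ∷ m) (y ∷ a) (z ∷ b) rewrite ·-distribˡ-⊕ m a b =
  solve 5 (λ x y z u v → x :* (y :+ z) :+ (u :+ v) := x :* y :+ u :+ (x :* z :+ v))
    refl x y z (m · a) (m · b)

·-distribʳ-⊕ : ∀ {d} (a b m : Pt d) → (a ⊕ b) · m ≡ a · m + b · m
·-distribʳ-⊕ []      []      []      = sym (+-identityˡ 0ℚ)
·-distribʳ-⊕ (y ∷ a) (z ∷ b) (x ∷ m) rewrite ·-distribʳ-⊕ a b m =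
  solve 5 (λ x y z u v → (y :+ z) :* x :+ (u :+ v) := y :* x :+ u :+ (z :* x :+ v))
    refl x y z (a · m) (b · m)

·-scaleʳ : ∀ {d} (m : Pt d) c a → m · scale c a ≡ c * (m · a)
·-scaleʳ []      c []      = sym (*-zeroʳ c)
·-scaleʳ (x ∷ m) c (y ∷ a) rewrite ·-scaleʳ m c a =
  solve 4 (λ x c y u → x :* (c :* y) :+ c :* u := c :* (x :* y :+ u)) refl x c y (m · a)

·-scaleˡ : ∀ {d} c (a m : Pt d) → scale c a · m ≡ c * (a · m)
·-scaleˡ c []      []      = sym (*-zeroʳ c)
·-scaleˡ c (y ∷ a) (x ∷ m) rewrite ·-scaleˡ c a m =
  solve 4 (λ x c y u → c :* y :* x :+ c :* u := c :* (y :* x :+ u)) refl x c y (a · m)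

square-pos : ∀ {a} → a ≢ 0ℚ → 0ℚ < a * a
square-pos {a} a≢0 with <-cmp a 0ℚ
... | tri< a<0 _ _ = positive⁻¹ _ {{neg*neg⇒pos a {{negative a<0}} a {{negative a<0}}}}
... | tri≈ _ a≡0 _ = contradiction a≡0 a≢0
... | tri> _ _ a>0 = positive⁻¹ _ {{pos*pos⇒pos a {{positive a>0}} a {{positive a>0}}}}

square-nonNeg : ∀ a → 0ℚ ≤ a * a
square-nonNeg a with a ≟ 0ℚ
... | yes refl = ≤-refl
... | no a≢0   = <⇒≤ (square-pos a≢0)

module _ (a b : ℚ) where

  private
    square-gap : (a + a) * b + (a - b) * (a - b) ≡ a * a + b * b
    square-gap = solve 2 (λ a b → (a :+ a) :* b :+ (a :- b) :* (a :- b) := a :* a :+ b :* b) refl a b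

  2ab≤a²+b² : (a + a) * b ≤ a * a + b * b
  2ab≤a²+b² = begin
    (a + a) * b                   ≡⟨ sym (+-identityʳ _) ⟩
    (a + a) * b + 0ℚ              ≤⟨ +-monoʳ-≤ ((a + a) * b) (square-nonNeg (a - b)) ⟩
    (a + a) * b + (a - b) * (a - b) ≡⟨ square-gap ⟩
    a * a + b * b                 ∎
    where open ≤-Reasoning

  2ab<a²+b² : a ≢ b → (a + a) * b < a * a + b * b
  2ab<a²+b² a≢b = begin-strict
    (a + a) * b                   ≡⟨ sym (+-identityʳ _) ⟩
    (a + a) * b + 0ℚ              <⟨ +-monoʳ-< ((a + a) * b) (square-pos (a≢b ∘ x∙y⁻¹≈ε⇒x≈y a b)) ⟩
    (a + a) * b + (a - b) * (a - b) ≡⟨ square-gap ⟩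
    a * a + b * b                 ∎
    where open ≤-Reasoning

2p·q≤p·p+q·q : ∀ {d} (p q : Pt d) → (p ⊕ p) · q ≤ p · p + q · q
2p·q≤p·p+q·q []      []      = ≤-refl
2p·q≤p·p+q·q (a ∷ p) (b ∷ q) =
  subst ((a + a) * b + (p ⊕ p) · q ≤_) (+-interchange (a * a) (b * b) (p · p) (q · q))
    (+-mono-≤ (2ab≤a²+b² a b) (2p·q≤p·p+q·q p q))

2p·q<p·p+q·q : ∀ {d} {p q : Pt d} → q ≢ p → (p ⊕ p) · q < p · p + q · q
2p·q<p·p+q·q {p = []}    {[]}    q≢p = contradiction refl q≢p
2p·q<p·p+q·q {p = a ∷ p} {b ∷ q} q≢p =
  subst ((a + a) * b + (p ⊕ p) · q <_) (+-interchange (a * a) (b * b) (p · p) (q · q)) head-or-tail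
  where
  head-or-tail : (a + a) * b + (p ⊕ p) · q < (a * a + b * b) + (p · p + q · q)
  head-or-tail with a ≟ b
  ... | yes refl = +-mono-≤-< (2ab≤a²+b² a a) (2p·q<p·p+q·q (q≢p ∘ cong (a ∷_)))
  ... | no a≢b   = +-mono-<-≤ (2ab<a²+b² a b a≢b) (2p·q≤p·p+q·q p q)

maximiser-vertex : ∀ {d} {S : PtSet d} (v p : Pt d) →
  (∀ q → S q → v · q + q · q ≤ v · p + p · p) → IsVertexWrt S (v ⊕ (p ⊕ p)) p
maximiser-vertex v p maximal q Sq q≢p = begin-strict
  (v ⊕ (p ⊕ p)) · q         ≡⟨ ·-distribʳ-⊕ v (p ⊕ p) q ⟩
  v · q + (p ⊕ p) · q       <⟨ +-monoʳ-< (v · q) (2p·q<p·p+q·q q≢p) ⟩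
  v · q + (p · p + q · q)   ≡⟨ solve 3 (λ x y z → x :+ (y :+ z) := x :+ z :+ y) refl (v · q) (p · p) (q · q) ⟩
  v · q + q · q + p · p     ≤⟨ +-monoˡ-≤ (p · p) (maximal q Sq) ⟩
  v · p + p · p + p · p     ≡⟨ +-assoc (v · p) (p · p) (p · p) ⟩
  v · p + (p · p + p · p)   ≡⟨ cong ((v · p) +_) (·-distribʳ-⊕ p p p) ⟨
  v · p + (p ⊕ p) · p       ≡⟨ ·-distribʳ-⊕ v (p ⊕ p) p ⟨
  (v ⊕ (p ⊕ p)) · p         ∎
  where open ≤-Reasoning

private
  ·-scale-⊕ : ∀ {d} (m x c : Pt d) w → m · (scale w x ⊕ c) ≡ w * (m · x) + m · c
  ·-scale-⊕ m x c w = trans (·-distribˡ-⊕ m (scale w x) c) (cong (_+ m · c) (·-scaleʳ m w x))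

  combination-step-< : ∀ {d} (m x p c : Pt d) w W →
    w * (m · x) + m · c < w * (m · p) + W * (m · p) → m · (scale w x ⊕ c) < (w + W) * (m · p)
  combination-step-< m x p c w W = subst₂ _<_ (sym (·-scale-⊕ m x c w)) (sym (*-distribʳ-+ (m · p) w W))

  ≡⊎<⇒≤ : ∀ {d} (m p : Pt d) {c} W → c ≡ scale W p ⊎ m · c < W * (m · p) → m · c ≤ W * (m · p)
  ≡⊎<⇒≤ m p W (inj₁ refl)  = ≤-reflexive (·-scaleʳ m W p)
  ≡⊎<⇒≤ m p W (inj₂ c<Wp) = <⇒≤ c<Wp

combination-≡⊎< : ∀ {d} {S : PtSet d} {m p : Pt d} → IsVertexWrt S m p →
  ∀ {ws} → All (λ { (x , w) → S x × 0ℚ ≤ w }) ws →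
  combination ws ≡ scale (weightSum ws) p ⊎ m · combination ws < weightSum ws * (m · p)
combination-≡⊎< {p = p} vertex [] = inj₁ (sym (scale-zeroˡ p))
combination-≡⊎< {S = S} {m} {p} vertex {(x , w) ∷ ws} ((Sx , 0≤w) ∷ hs)
  with x ≟ₚ p | combination-≡⊎< {S = S} {m} {p} vertex hs
... | yes refl | inj₁ c≡Wp = inj₁ (trans (cong (scale w x ⊕_) c≡Wp) (scale-distribʳ w (weightSum ws) x))
... | yes refl | inj₂ c<Wp =
  inj₂ (combination-step-< m x x (combination ws) w (weightSum ws) (+-monoʳ-< (w * (m · x)) c<Wp))
... | no x≢p | ih with w ≟ 0ℚ
...   | yes refl
        rewrite scale-zeroˡ x | ⊕-identityˡ (combination ws) | +-identityˡ (weightSum ws) = ih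
...   | no w≢0 = inj₂ (combination-step-< m x p (combination ws) w (weightSum ws)
                   (+-mono-<-≤ (*-monoʳ-<-pos w {{positive 0<w}} (vertex x Sx x≢p)) (≡⊎<⇒≤ m p (weightSum ws) ih)))
  where
  0<w : 0ℚ < w
  0<w = ≰⇒> (w≢0 ∘ λ w≤0 → ≤-antisym w≤0 0≤w)

IsVertexWrt-conv : ∀ {d} {S : PtSet d} {m p : Pt d} → IsVertexWrt S m p → IsVertexWrt (conv S) m p
IsVertexWrt-conv {S = S} {m} {p} vertex q (ws , hs , Σw≡1 , c≡q) q≢p
  with combination-≡⊎< {S = S} {m} {p} vertex hs
... | inj₁ c≡Wp = contradiction (begin
  q                          ≡⟨ c≡q ⟨
  combination ws             ≡⟨ c≡Wp ⟩
  scale (weightSum ws) p     ≡⟨ cong (λ W → scale W p) Σw≡1 ⟩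
  scale 1ℚ p                 ≡⟨ scale-identityˡ p ⟩
  p                          ∎) q≢p
  where open ≡-Reasoning
... | inj₂ c<Wp = subst₂ _<_ (cong (m ·_) c≡q) (trans (cong (_* (m · p)) Σw≡1) (*-identityˡ (m · p))) c<Wp

IsVertexWrt-antitone : ∀ {d} {P Q : PtSet d} {n p : Pt d} →
  (∀ {q} → P q → Q q) → IsVertexWrt Q n p → IsVertexWrt P n p
IsVertexWrt-antitone P⊆Q vertex q Pq = vertex q (P⊆Q Pq)

conv-mono : ∀ {d} {S T : PtSet d} → (∀ {x} → S x → T x) → ∀ {q} → conv S q → conv T q
conv-mono S⊆T (ws , hs , Σw≡1 , c≡q) = ws , All.map (λ (Sx , 0≤w) → S⊆T Sx , 0≤w) hs , Σw≡1 , c≡q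

conv-singleton : ∀ {d} {S : PtSet d} {x} → S x → conv S x
conv-singleton {x = x} Sx =
  (x , 1ℚ) ∷ [] , (Sx , nonNegative⁻¹ 1ℚ) ∷ [] , +-identityʳ 1ℚ ,
  trans (⊕-identityʳ (scale 1ℚ x)) (scale-identityˡ x)

Eventually : (ℚ → Set) → Set
Eventually P = ∃ λ K → ∀ {K′} → K ≤ K′ → P K′

eventually-∀∈ : ∀ {A : Set} {P : A → ℚ → Set} (xs : List A) →
  (∀ {x} → x ∈ xs → Eventually (P x)) → Eventually (λ K → ∀ {x} → x ∈ xs → P x K)
eventually-∀∈ []       _  = 0ℚ , λ _ ()
eventually-∀∈ (x ∷ xs) ev with ev (here refl) | eventually-∀∈ xs (ev ∘ there)
... | K₁ , h₁ | K₂ , h₂ = K₁ ⊔ K₂ , λ where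
  K≤K′ (here refl) → h₁ (≤-trans (p≤p⊔q K₁ K₂) K≤K′)
  K≤K′ (there x∈xs) → h₂ (≤-trans (p≤q⊔p K₁ K₂) K≤K′) x∈xs

eventually-dominates : ∀ a a′ b b′ → Eventually (λ K → a < a′ → K * a + b < K * a′ + b′)
eventually-dominates a a′ b b′ with a <? a′
... | no a≮a′ = 0ℚ , λ _ a<a′ → contradiction a<a′ a≮a′
... | yes a<a′ = K , λ {K′} K≤K′ _ → begin-strict
  K′ * a + b                    ≡⟨ +-identityʳ _ ⟨
  K′ * a + b + 0ℚ               <⟨ +-monoʳ-< (K′ * a + b) 0<δ ⟩
  K′ * a + b + δ                ≡⟨ solve 5 (λ k a b b′ δ → k :* a :+ b :+ δ := k :* a :+ ((b :- b′ :+ δ) :+ b′))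
                                     refl K′ a b b′ δ ⟩
  K′ * a + ((b - b′ + δ) + b′)   ≡⟨ cong (λ t → K′ * a + (t + b′)) Kδ≡ ⟨
  K′ * a + (K * δ + b′)          ≤⟨ +-monoʳ-≤ (K′ * a) (+-monoˡ-≤ b′ (*-monoʳ-≤-nonNeg δ K≤K′)) ⟩
  K′ * a + (K′ * δ + b′)         ≡⟨ solve 4 (λ k a a′ b′ → k :* a :+ (k :* (a′ :- a) :+ b′) := k :* a′ :+ b′)
                                     refl K′ a a′ b′ ⟩
  K′ * a′ + b′                   ∎
  where
  open ≤-Reasoning
  δ : ℚ
  δ = a′ - a
  0<δ : 0ℚ < δ
  0<δ = subst (_< δ) (+-inverseʳ a) (+-monoˡ-< (- a) a<a′)
  instance
    δ-positive : Positive δ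
    δ-positive = positive 0<δ
    δ-nonNegative : NonNegative δ
    δ-nonNegative = pos⇒nonNeg δ
    δ-nonZero : NonZero δ
    δ-nonZero = pos⇒nonZero δ
  K : ℚ
  K = (b - b′ + δ) * 1/ δ
  Kδ≡ : K * δ ≡ b - b′ + δ
  Kδ≡ = trans (*-assoc (b - b′ + δ) (1/ δ) δ) (trans (cong ((b - b′ + δ) *_) (*-inverseˡ δ)) (*-identityʳ _))

module _ {d : ℕ} (f : Poly d) where

  frame⁺⇒frame : ∀ {x} → frame⁺ f x → frame f x
  frame⁺⇒frame (e , e↦x , 0<c) = e , e↦x , ≢-sym (ℤ.<⇒≢ 0<c)

  frame⁻⇒frame : ∀ {x} → frame⁻ f x → frame f x
  frame⁻⇒frame (e , e↦x , c<0) = e , e↦x , ℤ.<⇒≢ c<0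

  frame⇒frame⁺⊎frame⁻ : ∀ {x} → frame f x → frame⁺ f x ⊎ frame⁻ f x
  frame⇒frame⁺⊎frame⁻ (e , e↦x , c≢0) with ℤ.<-cmp (coeff f e) ℤ.0ℤ
  ... | tri< c<0 _ _ = inj₂ (e , e↦x , c<0)
  ... | tri≈ _ c≡0 _ = contradiction c≡0 c≢0
  ... | tri> _ _ 0<c = inj₁ (e , e↦x , 0<c)

  private
    coeff≢0? : ∀ e → Dec (coeff f e ≢ ℤ.0ℤ)
    coeff≢0? e = ¬? (coeff f e ℤ.≟ ℤ.0ℤ)

  frameList : List (Pt d)
  frameList = map embed (filter coeff≢0? (support f))

  ∈-frameList⁺ : ∀ {x} → frame f x → x ∈ frameList
  ∈-frameList⁺ (e , refl , c≢0) = ∈-map⁺ embed (∈-filter⁺ coeff≢0? (complete f e c≢0) c≢0)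

  ∈-frameList⁻ : ∀ {x} → x ∈ frameList → frame f x
  ∈-frameList⁻ x∈L with ∈-map⁻ embed x∈L
  ... | e , e∈ , refl = e , refl , proj₂ (∈-filter⁻ coeff≢0? {xs = support f} e∈)

  frame⁻∪｛⁺｝⊆frame : ∀ {p q} → frame⁺ f p → (frame⁻ f ∪ ｛ p ｝) q → frame f q
  frame⁻∪｛⁺｝⊆frame p⁺ (inj₁ q⁻)   = frame⁻⇒frame q⁻
  frame⁻∪｛⁺｝⊆frame p⁺ (inj₂ refl) = frame⁺⇒frame p⁺

positive-vertex : ∀ {d} (f : Poly d) {p′ n′ : Pt d} → frame⁺ f p′ → IsVertexWrt (frame⁻ f) n′ p′ →
  Σ (Pt d) λ p → Σ (Pt d) λ m → frame⁺ f p × IsVertexWrt (conv (frame f)) m p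
positive-vertex {d} f {p′} {n′} p′⁺ p′-vertex =
  p , m , p⁺ , IsVertexWrt-conv {S = frame f} {m} {p} (maximiser-vertex (scale K n′) p ψ-maximal)
  where
  L : List (Pt d)
  L = frameList f

  Dominates : Pt d → ℚ → Set
  Dominates x K = n′ · x < n′ · p′ → K * (n′ · x) + x · x < K * (n′ · p′) + p′ · p′

  K,dominates : Eventually (λ K → ∀ {x} → x ∈ L → Dominates x K)
  K,dominates = eventually-∀∈ {P = Dominates} L (λ {x} _ → eventually-dominates (n′ · x) (n′ · p′) (x · x) (p′ · p′))

  K : ℚ
  K = proj₁ K,dominates

  dominates : ∀ {x} → x ∈ L → Dominates x K
  dominates = proj₂ K,dominates ≤-refl

  ψ : Pt d → ℚ
  ψ x = scale K n′ · x + x · x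

  ψ≡ : ∀ x → K * (n′ · x) + x · x ≡ ψ x
  ψ≡ x = cong (_+ x · x) (sym (·-scaleˡ K n′ x))

  p : Pt d
  p = argmax ψ p′ L

  m : Pt d
  m = scale K n′ ⊕ (p ⊕ p)

  ψ-maximal : ∀ q → frame f q → ψ q ≤ ψ p
  ψ-maximal q fq = All.lookup (f[xs]≤f[argmax] {f = ψ} p′ L) (∈-frameList⁺ f fq)

  p∈frame : frame f p
  p∈frame = argmax-all ψ (frame⁺⇒frame f p′⁺) (All.tabulate (∈-frameList⁻ f))

  p⁺ : frame⁺ f p
  p⁺ = sign (p ≟ₚ p′) (frame⇒frame⁺⊎frame⁻ f p∈frame)
    where
    sign : Dec (p ≡ p′) → frame⁺ f p ⊎ frame⁻ f p → frame⁺ f p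
    sign (yes p≡p′) _        = subst (frame⁺ f) (sym p≡p′) p′⁺
    sign (no _)     (inj₁ p⁺) = p⁺
    sign (no p≢p′)  (inj₂ p⁻) = contradiction (<-≤-trans ψp<ψp′ (f[⊥]≤f[argmax] {f = ψ} p′ L)) (<-irrefl refl)
      where
      ψp<ψp′ : ψ p < ψ p′
      ψp<ψp′ = subst₂ _<_ (ψ≡ p) (ψ≡ p′) (dominates (∈-frameList⁺ f p∈frame) (p′-vertex p p⁻ p≢p′))

lemma5 : (d : ℕ) (f : Poly d) →
    (Σ (Pt d) λ p → Σ (Pt d) λ n → frame⁺ f p × IsVertexWrt (conv (frame f)) n p)
    ⇔
    (Σ (Pt d) λ p′ → Σ (Pt d) λ n′ → frame⁺ f p′ × IsVertexWrt (conv (frame⁻ f ∪ ｛ p′ ｝)) n′ p′)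
lemma5 d f = mk⇔
  (λ (p , n , p⁺ , vertex) →
     p , n , p⁺ , IsVertexWrt-antitone {n = n} {p} (conv-mono (frame⁻∪｛⁺｝⊆frame f p⁺)) vertex)
  (λ (p′ , n′ , p′⁺ , vertex′) →
     positive-vertex f {p′} {n′} p′⁺ (IsVertexWrt-antitone {n = n′} {p′} (conv-singleton ∘ inj₁) vertex′))
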